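{- Let $0<\epsilon<1$. For any $k$ permutations $\sigma_1,\dots,\sigma_k:[n]\to[n]$ with $k\le \log\log n-\log\log\frac{1}{\epsilon}-2$, there is a partition of $B=[n]$ into subsets $C,B_1,B_2,\dots$ such that: (1) $|B_i|\ge 1/\epsilon$ for every $i$; (2) $|C|\le\sqrt{n}$; (3) for every $B_i=\{b_1,\dots,b_p\}$ with $b_1<b_2<\dots<b_p$ and every $j\in\{1,\dots,k\}$, the sequence $(\sigma_j(b_l))_{l=1}^{p}$ is monotonic (increasing or decreasing).
   Context: $\log$ denotes the binary logarithm.
   Formalization: The parameter ε ranges over the rationals strictly between 0 and 1. -}

module Defs where

open import Data.Nat using (ℕ; _*_; _^_; _≤_)
open import Data.Fin using (Fin; _<_)
import Data.Fin as F
open import Data.Fin.Subset using (Subset; _∈_)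
open import Data.Maybe using (Maybe; just; nothing)
open import Data.Maybe.Properties using (≡-dec)
open import Data.Vec using (tabulate)
open import Data.Sum using (_⊎_)
open import Relation.Nullary.Decidable using (does)

-- A partition of [n] = Fin n into C, B_1, ..., B_m is encoded by a labelling
-- lab : Fin n → Maybe (Fin m):  lab b = nothing  means b ∈ C,
--                               lab b = just i   means b ∈ B_i.
labelled : ∀ {n m} → (Fin n → Maybe (Fin m)) → Maybe (Fin m) → Subset n
labelled lab c = tabulate (λ b → does (≡-dec F._≟_ (lab b) c))

MonotoneOn : ∀ {n} → Subset n → (Fin n → Fin n) → Set
MonotoneOn S g =
  (∀ a b → a ∈ S → b ∈ S → a < b → g a < g b) ⊎
  (∀ a b → a ∈ S → b ∈ S → a < b → g b < g a)

-- With ε = p / q (0 < p < q), the hypothesis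
--   k ≤ log log n − log log (1/ε) − 2
-- is equivalent (log = log₂, n ≥ 2) to (q/p)^(2^(k+2)) ≤ n, i.e.
--   q^(2^(k+2)) ≤ n · p^(2^(k+2)).
-- (For n ≤ 1, log log n is undefined and this inequality fails since q > p.)
LogLogBound : ℕ → ℕ → ℕ → ℕ → Set
LogLogBound k p q n = q ^ (2 ^ (k Data.Nat.+ 2)) ≤ n * p ^ (2 ^ (k Data.Nat.+ 2))

module Submission where

-- Write ε = p/q and put a = ⌊q/p⌋, so that a + 1 > 1/ε and,
-- by the hypothesis on k, a^(2^(k+2)) ≤ n.  The partition is built greedily: as long as the set C of
-- unassigned elements has more than a^(2^k) elements, it contains a set of
-- more than a elements on which every σ_j is monotone; that set becomes the
-- next block.  The leftover C then satisfies |C|² ≤ a^(2^(k+1)) ≤ n.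

open import Defs
open import Data.Nat using (ℕ; _*_; _≤_; _<_; zero; suc; _+_; _^_; z≤n; s≤s; NonZero)
import Data.Nat.Properties as ℕ
open import Data.Nat.DivMod using (_/_; _%_; m≡m%n+[m/n]*n; m%n<n; m/n*n≤m)
open import Data.Fin using (Fin)
import Data.Fin as F
import Data.Fin.Properties as FinP
open import Data.Fin.Subset
  using (Subset; ∣_∣; _∈_; _∉_; _⊆_; _⊂_; _─_; _∪_; ⁅_⁆; Nonempty; Empty; inside; outside)
  renaming (⊥ to ∅)
import Data.Fin.Subset.Properties as SubsetP
open import Data.Fin.Permutation using (Permutation′; _⟨$⟩ʳ_)
open import Data.Vec using ([]; _∷_; here; there; tabulate)
import Data.Vec.Properties as VecP
open import Data.Maybe using (Maybe; just; nothing)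
import Data.Maybe as Maybe
open import Data.Maybe.Properties using (≡-dec)
import Data.Maybe.Properties as MaybeP
open import Data.Bool using (true)
open import Data.Product using (Σ; ∃; _×_; _,_; proj₁; proj₂)
open import Data.Sum using (_⊎_; inj₁; inj₂; [_,_]′)
import Data.Sum as Sum
open import Function using (_∘_)
open import Function.Bundles using (Injection)
open import Function.Definitions using (Injective)
open import Function.Properties.Inverse using (↔⇒↣)
open import Relation.Nullary using (¬_; Dec; yes; no; does; contradiction)
open import Relation.Nullary.Decidable using (_×-dec_; ¬?; dec-true)
open import Algebra.Properties.CommutativeSemigroup ℕ.*-commutativeSemigroup
  using () renaming (interchange to *-interchange)
open import Relation.Binary.PropositionalEquality
  using (_≡_; _≢_; refl; sym; trans; cong; subst; module ≡-Reasoning)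

select : ∀ {n} {P : Fin n → Set} → ((x : Fin n) → Dec (P x)) → Subset n
select P? = tabulate (λ x → does (P? x))

module _ {n} {P : Fin n → Set} (P? : (x : Fin n) → Dec (P x)) where

  private
    does-true : ∀ {A : Set} (a? : Dec A) → does a? ≡ true → A
    does-true (yes a) _ = a
    does-true (no _) ()

  ∈-select⁺ : ∀ {x} → P x → x ∈ select P?
  ∈-select⁺ {x} px = VecP.lookup⇒[]= x (select P?)
    (trans (VecP.lookup∘tabulate (λ y → does (P? y)) x) (dec-true (P? x) px))

  ∈-select⁻ : ∀ {x} → x ∈ select P? → P x
  ∈-select⁻ {x} x∈ = does-true (P? x)
    (trans (sym (VecP.lookup∘tabulate (λ y → does (P? y)) x)) (VecP.[]=⇒lookup x∈))

module _ {n m} (lab : Fin n → Maybe (Fin m)) where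

  ∈-labelled⁺ : ∀ {x c} → lab x ≡ c → x ∈ labelled lab c
  ∈-labelled⁺ {c = c} = ∈-select⁺ (λ y → ≡-dec F._≟_ (lab y) c)

  ∈-labelled⁻ : ∀ {x c} → x ∈ labelled lab c → lab x ≡ c
  ∈-labelled⁻ {c = c} = ∈-select⁻ (λ y → ≡-dec F._≟_ (lab y) c)

x∈p─q⇒x∉q : ∀ {n} {x : Fin n} (p q : Subset n) → x ∈ p ─ q → x ∉ q
x∈p─q⇒x∉q (s ∷ p) (outside ∷ q) here       ()
x∈p─q⇒x∉q (s ∷ p) (t ∷ q)       (there x∈) (there x∈q) = x∈p─q⇒x∉q p q x∈ x∈q

∣p∣≤∣q∣+∣p─q∣ : ∀ {n} (p q : Subset n) → ∣ p ∣ ≤ ∣ q ∣ + ∣ p ─ q ∣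
∣p∣≤∣q∣+∣p─q∣ []            []            = z≤n
∣p∣≤∣q∣+∣p─q∣ (outside ∷ p) (outside ∷ q) = ∣p∣≤∣q∣+∣p─q∣ p q
∣p∣≤∣q∣+∣p─q∣ (inside  ∷ p) (outside ∷ q) =
  ℕ.≤-trans (s≤s (∣p∣≤∣q∣+∣p─q∣ p q)) (ℕ.≤-reflexive (sym (ℕ.+-suc ∣ q ∣ ∣ p ─ q ∣)))
∣p∣≤∣q∣+∣p─q∣ (outside ∷ p) (inside  ∷ q) = ℕ.m≤n⇒m≤1+n (∣p∣≤∣q∣+∣p─q∣ p q)
∣p∣≤∣q∣+∣p─q∣ (inside  ∷ p) (inside  ∷ q) = s≤s (∣p∣≤∣q∣+∣p─q∣ p q)

∣Empty∣≡0 : ∀ {n} {p : Subset n} → Empty p → ∣ p ∣ ≡ 0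
∣Empty∣≡0 {n} empty = trans (cong ∣_∣ (SubsetP.Empty-unique empty)) (SubsetP.∣⊥∣≡0 n)

nonempty-of-size : ∀ {n} {p : Subset n} → 0 < ∣ p ∣ → Nonempty p
nonempty-of-size {p = p} 0<∣p∣ with SubsetP.nonempty? p
... | yes ne   = ne
... | no empty = contradiction (∣Empty∣≡0 empty) (ℕ.>⇒≢ 0<∣p∣)

IncreasingOn : ∀ {n m} → Subset n → (Fin n → Fin m) → Set
IncreasingOn S f = ∀ a b → a ∈ S → b ∈ S → a F.< b → f a F.< f b

DecreasingOn : ∀ {n m} → Subset n → (Fin n → Fin m) → Set
DecreasingOn S f = ∀ a b → a ∈ S → b ∈ S → a F.< b → f b F.< f a

Monotone : ∀ {n m} → Subset n → (Fin n → Fin m) → Set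
Monotone S f = IncreasingOn S f ⊎ DecreasingOn S f

monotone-⊆ : ∀ {n m} {S T : Subset n} {f : Fin n → Fin m} → T ⊆ S → Monotone S f → Monotone T f
monotone-⊆ T⊆S (inj₁ inc) = inj₁ λ a b a∈T b∈T → inc a b (T⊆S a∈T) (T⊆S b∈T)
monotone-⊆ T⊆S (inj₂ dec) = inj₂ λ a b a∈T b∈T → dec a b (T⊆S a∈T) (T⊆S b∈T)

module ErdősSzekeres {n m} (f : Fin n → Fin m) (f-injective : Injective _≡_ _≡_ f) where

  Dominated : Subset n → Fin n → Set
  Dominated S x = ∃ λ y → y ∈ S × x F.< y × f x F.< f y

  dominated? : ∀ S x → Dec (Dominated S x)
  dominated? S x = FinP.any? (λ y → y SubsetP.∈? S ×-dec x FinP.<? y ×-dec f x FinP.<? f y)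

  Peak : Subset n → Fin n → Set
  Peak S x = x ∈ S × ¬ Dominated S x

  peak? : ∀ S x → Dec (Peak S x)
  peak? S x = x SubsetP.∈? S ×-dec ¬? (dominated? S x)

  peaks : Subset n → Subset n
  peaks S = select (peak? S)

  peaks⊆ : ∀ S → peaks S ⊆ S
  peaks⊆ S x∈P = proj₁ (∈-select⁻ (peak? S) x∈P)

  -- A later peak cannot carry a larger value, and by injectivity not an
  -- equal one either: the peaks form a decreasing set.
  peaks-decreasing : ∀ S → DecreasingOn (peaks S) f
  peaks-decreasing S a b a∈P b∈P a<b = FinP.≤∧≢⇒< fb≤fa (FinP.<⇒≢ a<b ∘ f-injective ∘ sym)
    where
    fb≤fa : f b F.≤ f a
    fb≤fa = ℕ.≮⇒≥ λ fa<fb →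
      proj₂ (∈-select⁻ (peak? S) a∈P) (b , proj₁ (∈-select⁻ (peak? S) b∈P) , a<b , fa<fb)

  non-peak-dominated : ∀ {S x} → x ∈ S → x ∉ peaks S → Dominated S x
  non-peak-dominated {S} {x} x∈S x∉P with dominated? S x
  ... | yes dominated   = dominated
  ... | no undominated = contradiction (∈-select⁺ (peak? S) (x∈S , undominated)) x∉P

  record IncreasingChain (S : Subset n) (r : ℕ) : Set where
    field
      members    : Subset n
      members⊆S  : members ⊆ S
      increasing : IncreasingOn members f
      long       : r < ∣ members ∣
      top        : Fin n
      top∈       : top ∈ members
      below-top  : ∀ x → x ∈ members → x F.≤ top × f x F.≤ f top

  private
    ≤-both : ∀ {x y} → x ≡ y → x F.≤ y × f x F.≤ f y
    ≤-both refl = ℕ.≤-refl , ℕ.≤-refl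

    ∈-⁅⁆ : ∀ {x y : Fin n} {S : Subset n} → y ∈ S → x ∈ ⁅ y ⁆ → x ∈ S
    ∈-⁅⁆ {x} {y} {S} y∈S x∈⁅y⁆ = subst (_∈ S) (sym (SubsetP.x∈⁅y⁆⇒x≡y y x∈⁅y⁆)) y∈S

  singleton-chain : ∀ {S x} → x ∈ S → IncreasingChain S 0
  singleton-chain {S} {x} x∈S = record
    { members    = ⁅ x ⁆
    ; members⊆S  = ∈-⁅⁆ x∈S
    ; increasing = λ a b a∈ b∈ a<b →
        contradiction (trans (SubsetP.x∈⁅y⁆⇒x≡y x a∈) (sym (SubsetP.x∈⁅y⁆⇒x≡y x b∈))) (FinP.<⇒≢ a<b)
    ; long       = ℕ.≤-reflexive (sym (SubsetP.∣⁅x⁆∣≡1 x))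
    ; top        = x
    ; top∈       = SubsetP.x∈⁅x⁆ x
    ; below-top  = λ y y∈ → ≤-both (SubsetP.x∈⁅y⁆⇒x≡y x y∈)
    }

  extend-chain : ∀ {R S r} → R ⊆ S → (c : IncreasingChain R r) →
                 Dominated S (IncreasingChain.top c) → IncreasingChain S (suc r)
  extend-chain {R} {S} R⊆S c (y , y∈S , top<y , ftop<fy) = record
    { members    = members ∪ ⁅ y ⁆
    ; members⊆S  = λ x∈ → [ R⊆S ∘ members⊆S , ∈-⁅⁆ y∈S ]′ (SubsetP.x∈p∪q⁻ members ⁅ y ⁆ x∈)
    ; increasing = increasing′
    ; long       = ℕ.<-≤-trans (s≤s long) grows
    ; top        = y
    ; top∈       = y∈new
    ; below-top  = below-y
    }
    where
    open IncreasingChain c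

    y∈new : y ∈ members ∪ ⁅ y ⁆
    y∈new = SubsetP.x∈p∪q⁺ (inj₂ (SubsetP.x∈⁅x⁆ y))

    y∉members : y ∉ members
    y∉members y∈ = ℕ.<⇒≱ top<y (proj₁ (below-top y y∈))

    grows : ∣ members ∣ < ∣ members ∪ ⁅ y ⁆ ∣
    grows = SubsetP.p⊂q⇒∣p∣<∣q∣ (SubsetP.p⊆p∪q ⁅ y ⁆ , y , y∈new , y∉members)

    below-y : ∀ x → x ∈ members ∪ ⁅ y ⁆ → x F.≤ y × f x F.≤ f y
    below-y x x∈ with SubsetP.x∈p∪q⁻ members ⁅ y ⁆ x∈
    ... | inj₁ x∈m = let (x≤top , fx≤ftop) = below-top x x∈m in
                     ℕ.<⇒≤ (ℕ.≤-<-trans x≤top top<y) , ℕ.<⇒≤ (ℕ.≤-<-trans fx≤ftop ftop<fy)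
    ... | inj₂ x∈⁅y⁆ = ≤-both (SubsetP.x∈⁅y⁆⇒x≡y y x∈⁅y⁆)

    increasing′ : IncreasingOn (members ∪ ⁅ y ⁆) f
    increasing′ a b a∈ b∈ a<b with SubsetP.x∈p∪q⁻ members ⁅ y ⁆ b∈
    ... | inj₂ b∈⁅y⁆ with refl ← SubsetP.x∈⁅y⁆⇒x≡y y b∈⁅y⁆ =
      FinP.≤∧≢⇒< (proj₂ (below-y a a∈)) (FinP.<⇒≢ a<b ∘ f-injective)
    ... | inj₁ b∈m with SubsetP.x∈p∪q⁻ members ⁅ y ⁆ a∈
    ...   | inj₁ a∈m = increasing a b a∈m b∈m a<b
    ...   | inj₂ a∈⁅y⁆ with refl ← SubsetP.x∈⁅y⁆⇒x≡y y a∈⁅y⁆ =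
      contradiction (proj₁ (below-y b b∈)) (ℕ.<⇒≱ a<b)

  DecreasingPart : Subset n → ℕ → Set
  DecreasingPart S r = ∃ λ D → D ⊆ S × DecreasingOn D f × ∣ S ∣ ≤ r * ∣ D ∣

  -- Removing the peaks: a chain among the non-peaks ends at a dominated
  -- element and so extends within S ...
  chain-past-peaks : ∀ {r} S → IncreasingChain (S ─ peaks S) r → IncreasingChain S (suc r)
  chain-past-peaks S c =
    extend-chain (SubsetP.p─q⊆p S (peaks S)) c
      (non-peak-dominated (SubsetP.p─q⊆p S (peaks S) top∈R) (x∈p─q⇒x∉q S (peaks S) top∈R))
    where
    open IncreasingChain c
    top∈R : top ∈ S ─ peaks S
    top∈R = members⊆S top∈

  -- ... while a decreasing part D of the non-peaks, together with the peaks
  -- themselves, gives a decreasing part of S: the larger of the two.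
  decreasing-past-peaks : ∀ {r} S → DecreasingPart (S ─ peaks S) r → DecreasingPart S (suc r)
  decreasing-past-peaks {r} S (D , D⊆R , D-decreasing , ∣R∣≤r∣D∣) = larger (∣ D ∣ ℕ.≤? ∣ peaks S ∣)
    where
    split : ∣ S ∣ ≤ ∣ peaks S ∣ + r * ∣ D ∣
    split = ℕ.≤-trans (∣p∣≤∣q∣+∣p─q∣ S (peaks S)) (ℕ.+-monoʳ-≤ ∣ peaks S ∣ ∣R∣≤r∣D∣)

    larger : Dec (∣ D ∣ ≤ ∣ peaks S ∣) → DecreasingPart S (suc r)
    larger (yes ∣D∣≤∣P∣) = peaks S , peaks⊆ S , peaks-decreasing S ,
      ℕ.≤-trans split (ℕ.+-monoʳ-≤ ∣ peaks S ∣ (ℕ.*-monoʳ-≤ r ∣D∣≤∣P∣))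
    larger (no ∣D∣≰∣P∣) = D , SubsetP.p─q⊆p S (peaks S) ∘ D⊆R , D-decreasing ,
      ℕ.≤-trans split (ℕ.+-monoˡ-≤ (r * ∣ D ∣) (ℕ.<⇒≤ (ℕ.≰⇒> ∣D∣≰∣P∣)))

  chain-or-decreasing : ∀ r S → IncreasingChain S r ⊎ DecreasingPart S r
  chain-or-decreasing zero S with SubsetP.nonempty? S
  ... | yes (x , x∈S) = inj₁ (singleton-chain x∈S)
  ... | no empty      = inj₂ (∅ , SubsetP.⊆-min S , (λ a b a∈∅ → contradiction a∈∅ SubsetP.∉⊥) ,
                              ℕ.≤-reflexive (∣Empty∣≡0 empty))
  chain-or-decreasing (suc r) S =
    Sum.map (chain-past-peaks S) (decreasing-past-peaks {r} S) (chain-or-decreasing r (S ─ peaks S))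

  erdős-szekeres : ∀ r S → r * r < ∣ S ∣ → ∃ λ T → T ⊆ S × r < ∣ T ∣ × Monotone T f
  erdős-szekeres r S large with chain-or-decreasing r S
  ... | inj₁ c = members , members⊆S , long , inj₁ increasing
    where open IncreasingChain c
  ... | inj₂ (D , D⊆S , D-decreasing , ∣S∣≤r∣D∣) =
    D , D⊆S , ℕ.*-cancelˡ-< r r ∣ D ∣ (ℕ.<-≤-trans large ∣S∣≤r∣D∣) , inj₂ D-decreasing

extendBy : ∀ {n m} → Subset n → (Fin n → Maybe (Fin m)) → Fin n → Maybe (Fin (suc m))
extendBy T lab x with x SubsetP.∈? T
... | yes _ = just F.zero
... | no  _ = Maybe.map F.suc (lab x)

map-suc≢just-zero : ∀ {m} (o : Maybe (Fin m)) → Maybe.map F.suc o ≢ just F.zero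
map-suc≢just-zero nothing  ()
map-suc≢just-zero (just _) ()

module _ {n m} (T : Subset n) (lab : Fin n → Maybe (Fin m)) where

  private
    lab′ = extendBy T lab

    value-∈ : ∀ {x} → x ∈ T → lab′ x ≡ just F.zero
    value-∈ {x} x∈T with x SubsetP.∈? T
    ... | yes _    = refl
    ... | no  x∉T = contradiction x∈T x∉T

  new-block⊆T : labelled lab′ (just F.zero) ⊆ T
  new-block⊆T {x} x∈B with x SubsetP.∈? T | ∈-labelled⁻ lab′ x∈B
  ... | yes x∈T | _  = x∈T
  ... | no  _   | eq = contradiction eq (map-suc≢just-zero (lab x))

  T⊆new-block : T ⊆ labelled lab′ (just F.zero)
  T⊆new-block x∈T = ∈-labelled⁺ lab′ (value-∈ x∈T)

  shifted-block⊆ : ∀ i → labelled lab′ (just (F.suc i)) ⊆ labelled lab (just i)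
  shifted-block⊆ i {x} x∈B with x SubsetP.∈? T | ∈-labelled⁻ lab′ x∈B
  ... | yes _ | ()
  ... | no  _ | eq = ∈-labelled⁺ lab (MaybeP.map-injective FinP.suc-injective {y = just i} eq)

  module _ (T⊆unlabelled : T ⊆ labelled lab nothing) where

    private
      value-labelled : ∀ {x i} → lab x ≡ just i → lab′ x ≡ just (F.suc i)
      value-labelled {x} labx≡i with x SubsetP.∈? T
      ... | yes x∈T = contradiction (trans (sym labx≡i) (∈-labelled⁻ lab (T⊆unlabelled x∈T))) λ ()
      ... | no  _   = cong (Maybe.map F.suc) labx≡i

    block⊆shifted : ∀ i → labelled lab (just i) ⊆ labelled lab′ (just (F.suc i))
    block⊆shifted i x∈B = ∈-labelled⁺ lab′ (value-labelled (∈-labelled⁻ lab x∈B))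

    unlabelled-shrinks : Nonempty T → labelled lab′ nothing ⊂ labelled lab nothing
    unlabelled-shrinks (y , y∈T) = still-unlabelled , y , T⊆unlabelled y∈T , y-labelled
      where
      still-unlabelled : labelled lab′ nothing ⊆ labelled lab nothing
      still-unlabelled {x} x∈U with x SubsetP.∈? T | ∈-labelled⁻ lab′ x∈U
      ... | yes _ | ()
      ... | no  _ | eq = ∈-labelled⁺ lab (MaybeP.map-injective FinP.suc-injective {y = nothing} eq)

      y-labelled : y ∉ labelled lab′ nothing
      y-labelled y∈U with () ← trans (sym (value-∈ y∈T)) (∈-labelled⁻ lab′ y∈U)

module GreedyPartition {n} (Good : Subset n → Set) (good-⊆ : ∀ {S T} → T ⊆ S → Good S → Good T)
                       (a b : ℕ) (extract : ∀ S → b < ∣ S ∣ → ∃ λ T → T ⊆ S × a < ∣ T ∣ × Good T) where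

  GoodBlocks : ∀ {m} → (Fin n → Maybe (Fin m)) → Set
  GoodBlocks lab = ∀ i → a < ∣ labelled lab (just i) ∣ × Good (labelled lab (just i))

  Partition : Set
  Partition = ∃ λ m → ∃ λ (lab : Fin n → Maybe (Fin m)) → GoodBlocks lab × ∣ labelled lab nothing ∣ ≤ b

  extend-blocks : ∀ {m} (lab : Fin n → Maybe (Fin m)) {T} → T ⊆ labelled lab nothing →
                  a < ∣ T ∣ → Good T → GoodBlocks lab → GoodBlocks (extendBy T lab)
  extend-blocks lab {T} T⊆U long good blocks F.zero =
    ℕ.<-≤-trans long (SubsetP.p⊆q⇒∣p∣≤∣q∣ (T⊆new-block T lab)) , good-⊆ (new-block⊆T T lab) good
  extend-blocks lab {T} T⊆U long good blocks (F.suc i) =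
    ℕ.<-≤-trans (proj₁ (blocks i)) (SubsetP.p⊆q⇒∣p∣≤∣q∣ (block⊆shifted T lab T⊆U i)) ,
    good-⊆ (shifted-block⊆ T lab i) (proj₂ (blocks i))

  -- Extract blocks while more than b elements are unlabelled; each step
  -- labels at least one element, so `fuel` unlabelled elements suffice.
  refine : ∀ fuel {m} (lab : Fin n → Maybe (Fin m)) → GoodBlocks lab →
           ∣ labelled lab nothing ∣ ≤ fuel → Partition
  refine fuel lab blocks _ with ∣ labelled lab nothing ∣ ℕ.≤? b
  ... | yes few = _ , lab , blocks , few
  refine zero lab blocks ≤0 | no many = contradiction (ℕ.≤-trans ≤0 z≤n) many
  refine (suc fuel) lab blocks ≤fuel | no many =
    let (T , T⊆U , long , good) = extract (labelled lab nothing) (ℕ.≰⇒> many)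
        shrinks = unlabelled-shrinks T lab T⊆U (nonempty-of-size (ℕ.≤-<-trans z≤n long))
    in refine fuel (extendBy T lab) (extend-blocks lab T⊆U long good blocks)
              (ℕ.≤-pred (ℕ.<-≤-trans (SubsetP.p⊂q⇒∣p∣<∣q∣ shrinks) ≤fuel))

  greedy-partition : Partition
  greedy-partition = refine n {0} (λ _ → nothing) (λ ()) (SubsetP.∣p∣≤n (labelled {m = 0} (λ _ → nothing) nothing))

pow-2^-suc : ∀ x k → x ^ (2 ^ suc k) ≡ x ^ (2 ^ k) * x ^ (2 ^ k)
pow-2^-suc x k = begin
  x ^ (2 ^ k + (2 ^ k + 0))   ≡⟨ cong (λ e → x ^ (2 ^ k + e)) (ℕ.+-identityʳ (2 ^ k)) ⟩
  x ^ (2 ^ k + 2 ^ k)         ≡⟨ ℕ.^-distribˡ-+-* x (2 ^ k) (2 ^ k) ⟩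
  x ^ (2 ^ k) * x ^ (2 ^ k)   ∎
  where open ≡-Reasoning

simultaneously-monotone : ∀ {n m} k a (fs : Fin k → Fin n → Fin m) → (∀ j → Injective _≡_ _≡_ (fs j)) →
                          ∀ S → a ^ (2 ^ k) < ∣ S ∣ →
                          ∃ λ T → T ⊆ S × a < ∣ T ∣ × (∀ j → Monotone T (fs j))
simultaneously-monotone zero a fs _ S large =
  S , (λ x∈S → x∈S) , subst (_< ∣ S ∣) (ℕ.*-identityʳ a) large , λ ()
simultaneously-monotone (suc k) a fs injective S large =
  let (T₀ , T₀⊆S , long₀ , mono₀) = ErdősSzekeres.erdős-szekeres (fs F.zero) (injective F.zero)
                                      (a ^ (2 ^ k)) S (subst (_< ∣ S ∣) (pow-2^-suc a k) large)
      (T , T⊆T₀ , long , monos)   = simultaneously-monotone k a (fs ∘ F.suc) (injective ∘ F.suc) T₀ long₀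
  in T , T₀⊆S ∘ T⊆T₀ , long , λ { F.zero → monotone-⊆ T⊆T₀ mono₀ ; (F.suc j) → monos j }

permutation-injective : ∀ {n} (π : Permutation′ n) → Injective _≡_ _≡_ (π ⟨$⟩ʳ_)
permutation-injective π = Injection.injective (↔⇒↣ π)

m<[1+m/n]*n : ∀ m n .{{_ : NonZero n}} → m < suc (m / n) * n
m<[1+m/n]*n m n = begin-strict
  m                   ≡⟨ m≡m%n+[m/n]*n m n ⟩
  m % n + m / n * n   <⟨ ℕ.+-monoˡ-< (m / n * n) (m%n<n m n) ⟩
  n + m / n * n       ∎
  where open ℕ.≤-Reasoning

^-distribʳ-* : ∀ x y t → (x * y) ^ t ≡ x ^ t * y ^ t
^-distribʳ-* x y zero    = refl
^-distribʳ-* x y (suc t) = begin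
  x * y * (x * y) ^ t       ≡⟨ cong (x * y *_) (^-distribʳ-* x y t) ⟩
  x * y * (x ^ t * y ^ t)   ≡⟨ *-interchange x y (x ^ t) (y ^ t) ⟩
  x * x ^ t * (y * y ^ t)   ∎
  where open ≡-Reasoning

[m/n]^t≤ : ∀ m n N t .{{_ : NonZero n}} → m ^ t ≤ N * n ^ t → (m / n) ^ t ≤ N
[m/n]^t≤ m n N t bound = ℕ.*-cancelʳ-≤ ((m / n) ^ t) N (n ^ t) {{ℕ.m^n≢0 n t}} (begin
  (m / n) ^ t * n ^ t   ≡⟨ ^-distribʳ-* (m / n) n t ⟨
  (m / n * n) ^ t       ≤⟨ ℕ.^-monoˡ-≤ t (m/n*n≤m m n) ⟩
  m ^ t                 ≤⟨ bound ⟩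
  N * n ^ t             ∎)
  where open ℕ.≤-Reasoning

n≤n*n : ∀ x → x ≤ x * x
n≤n*n zero        = z≤n
n≤n*n x@(suc _)   = ℕ.m≤m*n x x

square-bound : ∀ {c N} x k → c ≤ x ^ (2 ^ k) → x ^ (2 ^ (k + 2)) ≤ N → c * c ≤ N
square-bound {c} {N} x k c≤ bound = begin
  c * c                                 ≤⟨ ℕ.*-mono-≤ c≤ c≤ ⟩
  x ^ (2 ^ k) * x ^ (2 ^ k)             ≡⟨ pow-2^-suc x k ⟨
  x ^ (2 ^ suc k)                       ≤⟨ n≤n*n (x ^ (2 ^ suc k)) ⟩
  x ^ (2 ^ suc k) * x ^ (2 ^ suc k)     ≡⟨ pow-2^-suc x (suc k) ⟨
  x ^ (2 ^ (2 + k))                     ≡⟨ cong (λ e → x ^ (2 ^ e)) (ℕ.+-comm 2 k) ⟩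
  x ^ (2 ^ (k + 2))                     ≤⟨ bound ⟩
  N                                     ∎
  where open ℕ.≤-Reasoning

-- With a = ⌊q/p⌋: blocks of more than a elements have at least q/p = 1/ε
-- elements, and by `LogLogBound` a^(2^(k+2)) ≤ n, so a leftover of at most
-- a^(2^k) elements has size at most √n.
lemma12 : (p q : ℕ) → 0 < p → p < q →
          (n k : ℕ) → (σ : Fin k → Permutation′ n) →
          LogLogBound k p q n →
          Σ ℕ (λ m → Σ (Fin n → Maybe (Fin m)) (λ lab →
            ((i : Fin m) → q ≤ ∣ labelled lab (just i) ∣ * p)
            × (∣ labelled lab nothing ∣ * ∣ labelled lab nothing ∣ ≤ n)
            × ((i : Fin m) → (j : Fin k) → MonotoneOn (labelled lab (just i)) (σ j ⟨$⟩ʳ_))))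
lemma12 p@(suc _) q _ _ n k σ bound =
  let (m , lab , blocks , few) = greedy-partition in
  m , lab , (λ i → at-least-q/p (proj₁ (blocks i))) , square-bound a k few a^2^[k+2]≤n ,
  (λ i → proj₂ (blocks i))
  where
  a = q / p

  open GreedyPartition (λ T → ∀ j → MonotoneOn T (σ j ⟨$⟩ʳ_))
                       (λ T⊆S monotone j → monotone-⊆ T⊆S (monotone j))
                       a (a ^ (2 ^ k))
                       (simultaneously-monotone k a (λ j → σ j ⟨$⟩ʳ_) (permutation-injective ∘ σ))

  at-least-q/p : ∀ {s} → a < s → q ≤ s * p
  at-least-q/p a<s = ℕ.<⇒≤ (ℕ.<-≤-trans (m<[1+m/n]*n q p) (ℕ.*-monoˡ-≤ p a<s))

  a^2^[k+2]≤n : a ^ (2 ^ (k + 2)) ≤ n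
  a^2^[k+2]≤n = [m/n]^t≤ q p n (2 ^ (k + 2)) bound
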